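{- A right fountain triangulation $R$ of $\mathbb{N}$ (with fountain point $0$) is special if and only if only finitely many of the arcs $(\boldsymbol{y}^R_n,\boldsymbol{y}^R_{n+1})$, $n\ge1$, are boundary arcs (i.e. satisfy $\boldsymbol{y}^R_{n+1}-\boldsymbol{y}^R_n=1$).
   Context: Arcs are pairs $(a,b)$ of integers with $0\le a<b$; boundary arcs are those of the form $(a,a+1)$; arcs $(a,b),(c,d)$ cross if $a<c<b<d$ or $c<a<d<b$. A triangulation of $\mathbb{N}$ is a maximal set of pairwise noncrossing arcs. A right fountain triangulation with fountain point $0$ is such a triangulation $R$ containing $(0,n)$ for infinitely many $n$. $\boldsymbol{x}^R_n=1$ if $(0,n+1)\in R$ and $0$ otherwise ($n\ge 1$); $\boldsymbol{y}^R_n$ is the $(n+1)$-st positive integer $\ell$ with $(0,\ell)\in R$; the arcs $(\boldsymbol{y}^R_n,\boldsymbol{y}^R_{n+1})$ belong to $R$. Mutation at a non-boundary arc: replace it by the other diagonal of the unique quadrilateral of $R$ having it as diagonal. $R_1\sim R_2$ means $R_1$ can be mutated into $R_2$ using only finitely many mutations at arcs of the form $(0,\boldsymbol{y}_n)$ or $(\boldsymbol{y}_n,\boldsymbol{y}_{n+1})$ and possibly infinitely many mutations at other arcs. $R$ is special if there is a right fountain triangulation $R'\sim R$ with $\boldsymbol{y}^{R'}_{n+1}-\boldsymbol{y}^{R'}_n\ge 2$ for all $n\ge1$. -}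

module Defs where

open import Data.Nat using (ℕ; zero; suc; _+_; _<_; _≤_; _≥_; _≡ᵇ_)
open import Data.Bool using (Bool; true; false; if_then_else_; _∧_)
open import Data.Product using (Σ; ∃; _×_; _,_)
open import Data.Sum using (_⊎_)
open import Relation.Nullary using (¬_)
open import Relation.Binary.PropositionalEquality using (_≡_; _≢_)

-- A set of arcs: (a , b) belongs to T iff  T a b ≡ true.
-- (Membership is taken to be decidable; classically every set is.)
ArcSet : Set
ArcSet = ℕ → ℕ → Bool

_∈A_ : ℕ × ℕ → ArcSet → Set
(a , b) ∈A T = T a b ≡ true

Cross : ℕ → ℕ → ℕ → ℕ → Set
Cross a b c d = (a < c × c < b × b < d) ⊎ (c < a × a < d × d < b)

record IsTriangulation (T : ArcSet) : Set where
  field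
    arcs        : ∀ a b → (a , b) ∈A T → a < b
    noncrossing : ∀ a b c d → (a , b) ∈A T → (c , d) ∈A T → ¬ Cross a b c d
    maximal     : ∀ a b → a < b →
                  (∀ c d → (c , d) ∈A T → ¬ Cross a b c d) → (a , b) ∈A T

record IsRightFountain (T : ArcSet) : Set where
  field
    triangulation : IsTriangulation T
    fountain      : ∀ N → Σ ℕ λ n → N ≤ n × (0 , n) ∈A T

count0 : ArcSet → ℕ → ℕ
count0 T zero    = zero
count0 T (suc m) = (if T 0 (suc m) then suc else (λ k → k)) (count0 T m)

-- Y T n ℓ  :⇔  ℓ = y^T_n, the (n+1)-st positive integer ℓ with (0,ℓ) ∈ T.
Y : ArcSet → ℕ → ℕ → Set
Y T n ℓ = 1 ≤ ℓ × (0 , ℓ) ∈A T × count0 T ℓ ≡ suc n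

FountainArc : ArcSet → ℕ → ℕ → Set
FountainArc T a b = (a ≡ 0 × Σ ℕ λ n → Y T n b)
                  ⊎ (Σ ℕ λ n → Y T n a × Y T (suc n) b)

replace : ArcSet → ℕ → ℕ → ℕ → ℕ → ArcSet
replace T a b c d x y =
  if (x ≡ᵇ a) ∧ (y ≡ᵇ b) then false
  else if (x ≡ᵇ c) ∧ (y ≡ᵇ d) then true
  else T x y

MutAt : ArcSet → ℕ → ℕ → ArcSet → Set
MutAt T a b T' =
  Σ ℕ λ p → Σ ℕ λ q → Σ ℕ λ r → Σ ℕ λ s →
    p < q × q < r × r < s ×
    (p , q) ∈A T × (q , r) ∈A T × (r , s) ∈A T × (p , s) ∈A T ×
    (a , b) ∈A T ×
    ( (a ≡ p × b ≡ r × (∀ x y → T' x y ≡ replace T p r q s x y))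
    ⊎ (a ≡ q × b ≡ s × (∀ x y → T' x y ≡ replace T q s p r x y)))

Step : ArcSet → ArcSet → Set
Step T T' = (∀ x y → T' x y ≡ T x y) ⊎ (Σ ℕ λ a → Σ ℕ λ b → MutAt T a b T')

OrdinaryStep : ArcSet → ArcSet → Set
OrdinaryStep T T' = (∀ x y → T' x y ≡ T x y)
  ⊎ (Σ ℕ λ a → Σ ℕ λ b → ¬ FountainArc T a b × MutAt T a b T')

-- Finite sequences are padded with trivial steps.
_∼_ : ArcSet → ArcSet → Set
R₁ ∼ R₂ = Σ (ℕ → ArcSet) λ T →
    (∀ x y → T 0 x y ≡ R₁ x y)
  × (∀ k → Step (T k) (T (suc k)))
  × (Σ ℕ λ K → ∀ k → K ≤ k → OrdinaryStep (T k) (T (suc k)))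
  × (∀ x y → Σ ℕ λ K → ∀ k → K ≤ k → T k x y ≡ R₂ x y)

Special : ArcSet → Set
Special R = Σ ArcSet λ R' → IsRightFountain R' × R' ∼ R ×
  (∀ n → 1 ≤ n → ∀ a b → Y R' n a → Y R' (suc n) b → 2 + a ≤ b)

FinitelyManyBoundaryY : ArcSet → Set
FinitelyManyBoundaryY R =
  Σ ℕ λ N → ∀ n → N ≤ n → ∀ a b → Y R n a → Y R (suc n) b → b ≢ suc a

-- (⇒) A mutation at an arc other than (0, y_n) and (y_n, y_{n+1}) neither creates nor destroys
-- an arc at 0, and finitely many arbitrary mutations only touch a bounded region. So if R′ ∼ R,
-- then R′ and R have the same arcs (0, ℓ) for all large ℓ, and adjacent fountain points
-- y_n, y_n + 1 of R far out would be adjacent fountain points of R′.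
-- (⇐) If y_{n+1} − y_n ≥ 2 for all n > M, flipping (0, y_{M+1}) into (y_M, y_{M+2}) deletes the
-- fountain point y_{M+1} and shifts the later ones down by one index, so the gaps are ≥ 2 for all
-- n ≥ M. After M such flips all gaps with n ≥ 1 are ≥ 2, and the flips, undone in reverse
-- order, are finitely many mutations leading back to R.
module Submission where

open import Defs
open import Function.Base using (_∘_)
open import Function.Bundles using (_⇔_; mk⇔)
open import Data.Nat using (ℕ; zero; suc; _+_; _⊔_; _<_; _≤_; z≤n; s≤s; _≟_; _<?_)
open import Data.Nat.Properties
open import Data.Bool using (true; false; if_then_else_)
open import Data.Bool.Properties using (¬-not) renaming (_≟_ to _≟ᵇ_)
open import Data.Product using (Σ; ∃; ∃₂; _×_; _,_; proj₁; proj₂)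
open import Data.Product.Properties using (,-injective; ,-injectiveˡ; ,-injectiveʳ)
open import Data.Sum using (_⊎_; inj₁; inj₂)
open import Data.Empty using (⊥-elim)
open import Relation.Nullary using (¬_; Dec; yes; no; does; contradiction)
open import Relation.Nullary.Decidable using (map′; _×-dec_; dec-true; dec-false)
open import Relation.Binary using (tri<; tri≈; tri>)
open import Relation.Binary.PropositionalEquality
  using (_≡_; _≢_; refl; sym; trans; cong; cong₂; subst; subst₂; module ≡-Reasoning)
open import Relation.Binary.Construct.Closure.ReflexiveTransitive
  using (Star; ε; _◅_; _◅◅_; fold)

private
  variable
    T T′ R : ArcSet
    a b c d m n p q r s x y z M : ℕ

_≗₂_ : ArcSet → ArcSet → Set
T ≗₂ T′ = ∀ x y → T x y ≡ T′ x y

≢-by-fst : x ≢ a → (x , y) ≢ (a , b)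
≢-by-fst x≢a = x≢a ∘ ,-injectiveˡ

≢-by-snd : y ≢ b → (x , y) ≢ (a , b)
≢-by-snd y≢b = y≢b ∘ ,-injectiveʳ

-- `does ((x , y) ≟ᴬ (a , b))` is definitionally the test `(x ≡ᵇ a) ∧ (y ≡ᵇ b)` of `replace`.
_≟ᴬ_ : (u v : ℕ × ℕ) → Dec (u ≡ v)
(x , y) ≟ᴬ (a , b) =
  map′ (λ (x≡a , y≡b) → cong₂ _,_ x≡a y≡b) ,-injective ((x ≟ a) ×-dec (y ≟ b))

_∈A?_ : (u : ℕ × ℕ) (T : ArcSet) → Dec (u ∈A T)
(x , y) ∈A? T = T x y ≟ᵇ true

if-does-yes : {P A : Set} (P? : Dec P) {t e : A} → P → (if does P? then t else e) ≡ t
if-does-yes P? P rewrite dec-true P? P = refl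

if-does-no : {P A : Set} (P? : Dec P) {t e : A} → ¬ P → (if does P? then t else e) ≡ e
if-does-no P? ¬P rewrite dec-false P? ¬P = refl

module _ (T : ArcSet) (a b c d : ℕ) where

  replace-removes : ¬ (a , b) ∈A replace T a b c d
  replace-removes ab∈ with () ← trans (sym (if-does-yes ((a , b) ≟ᴬ (a , b)) refl)) ab∈

  replace-adds : (c , d) ≢ (a , b) → (c , d) ∈A replace T a b c d
  replace-adds cd≢ab =
    trans (if-does-no ((c , d) ≟ᴬ _) cd≢ab) (if-does-yes ((c , d) ≟ᴬ (c , d)) refl)

  replace-elsewhere : (x , y) ≢ (a , b) → (x , y) ≢ (c , d) → replace T a b c d x y ≡ T x y
  replace-elsewhere {x} {y} xy≢ab xy≢cd =
    trans (if-does-no ((x , y) ≟ᴬ _) xy≢ab) (if-does-no ((x , y) ≟ᴬ _) xy≢cd)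

  replace-keeps : (x , y) ∈A T → (x , y) ≢ (a , b) → (x , y) ∈A replace T a b c d
  replace-keeps {x} {y} xy∈ xy≢ab with (x , y) ≟ᴬ (c , d)
  ... | yes refl = replace-adds xy≢ab
  ... | no xy≢cd = trans (replace-elsewhere xy≢ab xy≢cd) xy∈

  replace-∈ : ∀ x y → (x , y) ∈A replace T a b c d →
              (x , y) ≡ (c , d) ⊎ ((x , y) ≢ (a , b) × (x , y) ∈A T)
  replace-∈ x y xy∈ with (x , y) ≟ᴬ (a , b) | (x , y) ≟ᴬ (c , d)
  ... | yes refl | _         = contradiction xy∈ replace-removes
  ... | no _     | yes xy≡cd = inj₁ xy≡cd
  ... | no xy≢ab | no xy≢cd  = inj₂ (xy≢ab , trans (sym (replace-elsewhere xy≢ab xy≢cd)) xy∈)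

replace-involutive : (a , b) ∈A T → ¬ (c , d) ∈A T → (c , d) ≢ (a , b) →
                     replace (replace T a b c d) c d a b ≗₂ T
replace-involutive {a} {b} {T} {c} {d} ab∈ cd∉ cd≢ab x y
  with (x , y) ≟ᴬ (c , d) | (x , y) ≟ᴬ (a , b)
... | yes refl | _        =
  trans (¬-not (replace-removes (replace T a b c d) c d a b)) (sym (¬-not cd∉))
... | no _     | yes refl =
  trans (replace-adds (replace T a b c d) c d a b (cd≢ab ∘ sym)) (sym ab∈)
... | no xy≢cd | no xy≢ab =
  trans (replace-elsewhere (replace T a b c d) c d a b xy≢cd xy≢ab)
        (replace-elsewhere T a b c d xy≢ab xy≢cd)

∈-resp-≗₂ : T′ ≗₂ T → (x , y) ∈A T → (x , y) ∈A T′
∈-resp-≗₂ {x = x} {y} T′≗T xy∈ = trans (T′≗T x y) xy∈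

IsTriangulation-resp-≗₂ : T′ ≗₂ T → IsTriangulation T → IsTriangulation T′
IsTriangulation-resp-≗₂ {T′} {T} T′≗T tri = record
  { arcs        = λ a b ab∈ → arcs a b (∈-resp-≗₂ T≗T′ ab∈)
  ; noncrossing = λ a b c d ab∈ cd∈ →
      noncrossing a b c d (∈-resp-≗₂ T≗T′ ab∈) (∈-resp-≗₂ T≗T′ cd∈)
  ; maximal     = λ a b a<b compat →
      ∈-resp-≗₂ T′≗T (maximal a b a<b λ c d cd∈ → compat c d (∈-resp-≗₂ T′≗T cd∈))
  }
  where
  open IsTriangulation tri
  T≗T′ : T ≗₂ T′
  T≗T′ x y = sym (T′≗T x y)

-- Crossings and quadrilaterals

cross-sym : Cross a b c d → Cross c d a b
cross-sym (inj₁ χ) = inj₂ χ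
cross-sym (inj₂ χ) = inj₁ χ

cross-irrefl : ¬ Cross a b a b
cross-irrefl (inj₁ (a<a , _)) = n≮n _ a<a
cross-irrefl (inj₂ (a<a , _)) = n≮n _ a<a

Compatible : ArcSet → ℕ → ℕ → Set
Compatible T a b = ∀ c d → (c , d) ∈A T → ¬ Cross a b c d

boundaryArc-∈ : IsTriangulation T → (a , suc a) ∈A T
boundaryArc-∈ {a = a} tri = IsTriangulation.maximal tri a (suc a) ≤-refl nothing-crosses
  where
  nothing-crosses : Compatible _ a (suc a)
  nothing-crosses c d _ (inj₁ (a<c , c<1+a , _)) = <⇒≱ a<c (≤-pred c<1+a)
  nothing-crosses c d _ (inj₂ (_ , a<d , d<1+a)) = <⇒≱ a<d (≤-pred d<1+a)

record Quadrilateral (T : ArcSet) (p q r s : ℕ) : Set where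
  constructor quadrilateral
  field
    p<q : p < q
    q<r : q < r
    r<s : r < s
    pq∈ : (p , q) ∈A T
    qr∈ : (q , r) ∈A T
    rs∈ : (r , s) ∈A T
    ps∈ : (p , s) ∈A T

data CrossesSide (p q r s x y : ℕ) : Set where
  crosses-pq : Cross p q x y → CrossesSide p q r s x y
  crosses-qr : Cross q r x y → CrossesSide p q r s x y
  crosses-rs : Cross r s x y → CrossesSide p q r s x y
  crosses-ps : Cross p s x y → CrossesSide p q r s x y

crossesSide⇒incompatible : Quadrilateral T p q r s → CrossesSide p q r s x y →
                           ¬ Compatible T x y
crossesSide⇒incompatible Q (crosses-pq χ) compat = compat _ _ (Quadrilateral.pq∈ Q) (cross-sym χ)
crossesSide⇒incompatible Q (crosses-qr χ) compat = compat _ _ (Quadrilateral.qr∈ Q) (cross-sym χ)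
crossesSide⇒incompatible Q (crosses-rs χ) compat = compat _ _ (Quadrilateral.rs∈ Q) (cross-sym χ)
crossesSide⇒incompatible Q (crosses-ps χ) compat = compat _ _ (Quadrilateral.ps∈ Q) (cross-sym χ)

crossing-diagonal-qs : p < q → q < r → r < s → Cross q s x y →
                       (x , y) ≡ (p , r) ⊎ CrossesSide p q r s x y
crossing-diagonal-qs p<q q<r r<s (inj₁ (q<x , x<s , s<y)) =
  inj₂ (crosses-ps (inj₁ (<-trans p<q q<x , x<s , s<y)))
crossing-diagonal-qs {p} {r = r} {x = x} {y} p<q q<r r<s (inj₂ (x<q , q<y , y<s))
  with <-cmp x p | <-cmp y r
... | tri< x<p _ _ | _            = inj₂ (crosses-ps (inj₂ (x<p , <-trans p<q q<y , y<s)))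
... | tri> _ _ p<x | _            = inj₂ (crosses-pq (inj₁ (p<x , x<q , q<y)))
... | tri≈ _ x≡p _ | tri< y<r _ _ = inj₂ (crosses-qr (inj₂ (x<q , q<y , y<r)))
... | tri≈ _ x≡p _ | tri≈ _ y≡r _ = inj₁ (cong₂ _,_ x≡p y≡r)
... | tri≈ _ x≡p _ | tri> _ _ r<y = inj₂ (crosses-rs (inj₂ (<-trans x<q q<r , r<y , y<s)))

crossing-diagonal-pr : p < q → q < r → r < s → Cross p r x y →
                       (x , y) ≡ (q , s) ⊎ CrossesSide p q r s x y
crossing-diagonal-pr {q = q} {s = s} {x} {y} p<q q<r r<s (inj₁ (p<x , x<r , r<y))
  with <-cmp x q | <-cmp y s
... | tri< x<q _ _ | _            = inj₂ (crosses-pq (inj₁ (p<x , x<q , <-trans q<r r<y)))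
... | tri> _ _ q<x | _            = inj₂ (crosses-qr (inj₁ (q<x , x<r , r<y)))
... | tri≈ _ x≡q _ | tri< y<s _ _ = inj₂ (crosses-rs (inj₂ (x<r , r<y , y<s)))
... | tri≈ _ x≡q _ | tri≈ _ y≡s _ = inj₁ (cong₂ _,_ x≡q y≡s)
... | tri≈ _ x≡q _ | tri> _ _ s<y = inj₂ (crosses-ps (inj₁ (p<x , <-trans x<r r<s , s<y)))
crossing-diagonal-pr p<q q<r r<s (inj₂ (x<p , p<y , y<r)) =
  inj₂ (crosses-ps (inj₂ (x<p , p<y , <-trans y<r r<s)))

quadrilateral-flip-pr : Quadrilateral T p q r s → Quadrilateral (replace T p r q s) p q r s
quadrilateral-flip-pr {T} {p} {q} {r} {s} (quadrilateral p<q q<r r<s pq∈ qr∈ rs∈ ps∈) =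
  quadrilateral p<q q<r r<s
    (replace-keeps T p r q s pq∈ (≢-by-snd (<⇒≢ q<r)))
    (replace-keeps T p r q s qr∈ (≢-by-fst (>⇒≢ p<q)))
    (replace-keeps T p r q s rs∈ (≢-by-fst (>⇒≢ (<-trans p<q q<r))))
    (replace-keeps T p r q s ps∈ (≢-by-snd (>⇒≢ r<s)))

quadrilateral-flip-qs : Quadrilateral T p q r s → Quadrilateral (replace T q s p r) p q r s
quadrilateral-flip-qs {T} {p} {q} {r} {s} (quadrilateral p<q q<r r<s pq∈ qr∈ rs∈ ps∈) =
  quadrilateral p<q q<r r<s
    (replace-keeps T q s p r pq∈ (≢-by-fst (<⇒≢ p<q)))
    (replace-keeps T q s p r qr∈ (≢-by-snd (<⇒≢ r<s)))
    (replace-keeps T q s p r rs∈ (≢-by-fst (>⇒≢ q<r)))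
    (replace-keeps T q s p r ps∈ (≢-by-fst (<⇒≢ p<q)))

flip-isTriangulation : IsTriangulation T → Quadrilateral T p q r s →
  (a , b) ∈A T → c < d → Cross a b c d →
  (∀ x y → Cross c d x y → (x , y) ≡ (a , b) ⊎ CrossesSide p q r s x y) →
  (∀ x y → Cross a b x y → (x , y) ≡ (c , d) ⊎ CrossesSide p q r s x y) →
  Quadrilateral (replace T a b c d) p q r s →
  IsTriangulation (replace T a b c d)
flip-isTriangulation {T} {a = a} {b} {c} {d} tri Q ab∈ c<d χ cd-crossers ab-crossers Q′ =
  record { arcs = arcs′ ; noncrossing = noncrossing′ ; maximal = maximal′ }
  where
  open IsTriangulation tri
  flipped = replace T a b c d

  cd≢ab : (c , d) ≢ (a , b)
  cd≢ab e = cross-irrefl (subst (λ (u , v) → Cross a b u v) e χ)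

  only-ab-crosses-cd : (x , y) ∈A T → Cross c d x y → (x , y) ≡ (a , b)
  only-ab-crosses-cd {x} {y} xy∈ χ′ with cd-crossers x y χ′
  ... | inj₁ xy≡ab = xy≡ab
  ... | inj₂ side  = ⊥-elim (crossesSide⇒incompatible Q side λ u v → noncrossing x y u v xy∈)

  arcs′ : ∀ x y → (x , y) ∈A flipped → x < y
  arcs′ x y xy∈′ with replace-∈ T a b c d x y xy∈′
  ... | inj₁ refl      = c<d
  ... | inj₂ (_ , xy∈) = arcs x y xy∈

  noncrossing′ : ∀ x y u v → (x , y) ∈A flipped → (u , v) ∈A flipped → ¬ Cross x y u v
  noncrossing′ x y u v xy∈′ uv∈′ χ′
    with replace-∈ T a b c d x y xy∈′ | replace-∈ T a b c d u v uv∈′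
  ... | inj₁ refl          | inj₁ refl          = cross-irrefl χ′
  ... | inj₁ refl          | inj₂ (uv≢ab , uv∈) = uv≢ab (only-ab-crosses-cd uv∈ χ′)
  ... | inj₂ (xy≢ab , xy∈) | inj₁ refl          = xy≢ab (only-ab-crosses-cd xy∈ (cross-sym χ′))
  ... | inj₂ (_ , xy∈)     | inj₂ (_ , uv∈)     = noncrossing x y u v xy∈ uv∈ χ′

  maximal′ : ∀ x y → x < y → Compatible flipped x y → (x , y) ∈A flipped
  maximal′ x y x<y compat′ with (x , y) ≟ᴬ (c , d)
  ... | yes refl = replace-adds T a b c d cd≢ab
  ... | no xy≢cd = replace-keeps T a b c d (maximal x y x<y compat) xy≢ab
    where
    compat : Compatible T x y
    compat u v uv∈ χ′ with (u , v) ≟ᴬ (a , b)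
    ... | no uv≢ab = compat′ u v (replace-keeps T a b c d uv∈ uv≢ab) χ′
    ... | yes refl with ab-crossers x y (cross-sym χ′)
    ...   | inj₁ xy≡cd = xy≢cd xy≡cd
    ...   | inj₂ side  = crossesSide⇒incompatible Q′ side compat′
    xy≢ab : (x , y) ≢ (a , b)
    xy≢ab refl = compat′ c d (replace-adds T a b c d cd≢ab) χ

-- Mutations

data MutationView (T : ArcSet) : ℕ → ℕ → ArcSet → Set where
  flip-pr : Quadrilateral T p q r s → (p , r) ∈A T → T′ ≗₂ replace T p r q s →
            MutationView T p r T′
  flip-qs : Quadrilateral T p q r s → (q , s) ∈A T → T′ ≗₂ replace T q s p r →
            MutationView T q s T′

mutationView : MutAt T a b T′ → MutationView T a b T′
mutationView (_ , _ , _ , _ , p<q , q<r , r<s , pq∈ , qr∈ , rs∈ , ps∈ , ab∈ ,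
              inj₁ (refl , refl , T′≗)) =
  flip-pr (quadrilateral p<q q<r r<s pq∈ qr∈ rs∈ ps∈) ab∈ T′≗
mutationView (_ , _ , _ , _ , p<q , q<r , r<s , pq∈ , qr∈ , rs∈ , ps∈ , ab∈ ,
              inj₂ (refl , refl , T′≗)) =
  flip-qs (quadrilateral p<q q<r r<s pq∈ qr∈ rs∈ ps∈) ab∈ T′≗

mutAt-pr : Quadrilateral T p q r s → (p , r) ∈A T → T′ ≗₂ replace T p r q s → MutAt T p r T′
mutAt-pr (quadrilateral p<q q<r r<s pq∈ qr∈ rs∈ ps∈) pr∈ T′≗ =
  _ , _ , _ , _ , p<q , q<r , r<s , pq∈ , qr∈ , rs∈ , ps∈ , pr∈ , inj₁ (refl , refl , T′≗)

mutAt-qs : Quadrilateral T p q r s → (q , s) ∈A T → T′ ≗₂ replace T q s p r → MutAt T q s T′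
mutAt-qs (quadrilateral p<q q<r r<s pq∈ qr∈ rs∈ ps∈) qs∈ T′≗ =
  _ , _ , _ , _ , p<q , q<r , r<s , pq∈ , qr∈ , rs∈ , ps∈ , qs∈ , inj₂ (refl , refl , T′≗)

MutAt-resp-≗₂ : T′ ≗₂ R → MutAt T a b R → MutAt T a b T′
MutAt-resp-≗₂ T′≗R m with mutationView m
... | flip-pr Q pr∈ R≗ = mutAt-pr Q pr∈ λ x y → trans (T′≗R x y) (R≗ x y)
... | flip-qs Q qs∈ R≗ = mutAt-qs Q qs∈ λ x y → trans (T′≗R x y) (R≗ x y)

mutation-preserves-triangulation : IsTriangulation T → MutAt T a b T′ → IsTriangulation T′
mutation-preserves-triangulation tri m with mutationView m
... | flip-pr Q pr∈ T′≗ = IsTriangulation-resp-≗₂ T′≗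
  (flip-isTriangulation tri Q pr∈ (<-trans q<r r<s) (inj₁ (p<q , q<r , r<s))
     (λ _ _ → crossing-diagonal-qs p<q q<r r<s) (λ _ _ → crossing-diagonal-pr p<q q<r r<s)
     (quadrilateral-flip-pr Q))
  where open Quadrilateral Q
... | flip-qs Q qs∈ T′≗ = IsTriangulation-resp-≗₂ T′≗
  (flip-isTriangulation tri Q qs∈ (<-trans p<q q<r) (inj₂ (p<q , q<r , r<s))
     (λ _ _ → crossing-diagonal-pr p<q q<r r<s) (λ _ _ → crossing-diagonal-qs p<q q<r r<s)
     (quadrilateral-flip-qs Q))
  where open Quadrilateral Q

mutation-local : MutAt T a b T′ → Σ ℕ λ B → ∀ x y → B < y → T′ x y ≡ T x y
mutation-local {T = T} m with mutationView m
... | flip-pr {p} {q} {r} {s} Q _ T′≗ = s , λ x y s<y → trans (T′≗ x y)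
  (replace-elsewhere T p r q s (≢-by-snd (>⇒≢ (<-trans r<s s<y))) (≢-by-snd (>⇒≢ s<y)))
  where open Quadrilateral Q
... | flip-qs {p} {q} {r} {s} Q _ T′≗ = s , λ x y s<y → trans (T′≗ x y)
  (replace-elsewhere T q s p r (≢-by-snd (>⇒≢ s<y)) (≢-by-snd (>⇒≢ (<-trans r<s s<y))))
  where open Quadrilateral Q

mutation-preserves-rightFountain : IsRightFountain T → MutAt T a b T′ → IsRightFountain T′
mutation-preserves-rightFountain {T′ = T′} rf m = record
  { triangulation = mutation-preserves-triangulation triangulation m
  ; fountain      = fountain′
  }
  where
  open IsRightFountain rf
  B     = proj₁ (mutation-local m)
  local = proj₂ (mutation-local m)
  fountain′ : ∀ N → Σ ℕ λ n → N ≤ n × (0 , n) ∈A T′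
  fountain′ N with fountain (N + suc B)
  ... | n , N+1+B≤n , n∈ =
    n , m+n≤o⇒m≤o N N+1+B≤n , trans (local 0 n (m+n≤o⇒n≤o N N+1+B≤n)) n∈

flip-pr-reversible : IsTriangulation T → Quadrilateral T p q r s → (p , r) ∈A T →
                     MutAt (replace T p r q s) q s T
flip-pr-reversible {T} {p} {q} {r} {s} tri Q pr∈ =
  mutAt-qs (quadrilateral-flip-pr Q) (replace-adds T p r q s qs≢pr)
    (λ x y → sym (replace-involutive pr∈ qs∉ qs≢pr x y))
  where
  open Quadrilateral Q
  qs≢pr : (q , s) ≢ (p , r)
  qs≢pr = ≢-by-fst (>⇒≢ p<q)
  qs∉ : ¬ (q , s) ∈A T
  qs∉ qs∈ = IsTriangulation.noncrossing tri p r q s pr∈ qs∈ (inj₁ (p<q , q<r , r<s))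

-- Fountain points

count0-cong : ∀ T′ T → (∀ z → z ≤ n → T′ 0 z ≡ T 0 z) → count0 T′ n ≡ count0 T n
count0-cong {zero}  T′ T agree = refl
count0-cong {suc n} T′ T agree = cong₂ (λ β k → (if β then suc else λ k → k) k)
  (agree (suc n) ≤-refl) (count0-cong T′ T λ z z≤n → agree z (m≤n⇒m≤1+n z≤n))

count0-suc-cong : ∀ T′ T → T′ 0 (suc z) ≡ T 0 (suc z) → suc (count0 T′ z) ≡ count0 T z →
                  suc (count0 T′ (suc z)) ≡ count0 T (suc z)
count0-suc-cong {z} T′ T agree shifted with T′ 0 (suc z) | T 0 (suc z)
... | true  | true  = cong suc shifted
... | false | false = shifted
... | true  | false = contradiction agree λ ()
... | false | true  = contradiction agree λ ()

module _ (T : ArcSet) where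

  count0-suc-∈ : (0 , suc m) ∈A T → count0 T (suc m) ≡ suc (count0 T m)
  count0-suc-∈ {m} m∈ with T 0 (suc m)
  ... | true  = refl
  ... | false = contradiction m∈ λ ()

  count0-suc-∉ : ¬ (0 , suc m) ∈A T → count0 T (suc m) ≡ count0 T m
  count0-suc-∉ {m} m∉ with T 0 (suc m)
  ... | true  = contradiction refl m∉
  ... | false = refl

  count0-≤-suc : count0 T m ≤ count0 T (suc m)
  count0-≤-suc {m} with T 0 (suc m)
  ... | true  = n≤1+n _
  ... | false = ≤-refl

  count0-mono-≤ : m ≤ n → count0 T m ≤ count0 T n
  count0-mono-≤ {n = zero} z≤n = ≤-refl
  count0-mono-≤ {n = suc n} m≤1+n with m≤n⇒m<n∨m≡n m≤1+n
  ... | inj₁ (s≤s m≤n) = ≤-trans (count0-mono-≤ m≤n) count0-≤-suc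
  ... | inj₂ refl      = ≤-refl

  count0-≤ : count0 T m ≤ m
  count0-≤ {zero}  = z≤n
  count0-≤ {suc m} with T 0 (suc m)
  ... | true  = s≤s count0-≤
  ... | false = m≤n⇒m≤1+n count0-≤

  count0-< : (0 , n) ∈A T → m < n → count0 T m < count0 T n
  count0-< {n = suc n} n∈ (s≤s m≤n) =
    subst (_ <_) (sym (count0-suc-∈ n∈)) (s≤s (count0-mono-≤ m≤n))

  count0-flat : m ≤ n → (∀ z → m < z → z ≤ n → ¬ (0 , z) ∈A T) → count0 T n ≡ count0 T m
  count0-flat {n = zero} z≤n _ = refl
  count0-flat {n = suc n} m≤1+n gap with m≤n⇒m<n∨m≡n m≤1+n
  ... | inj₂ refl      = refl
  ... | inj₁ (s≤s m≤n) = trans (count0-suc-∉ (gap (suc n) (s≤s m≤n) ≤-refl))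
                               (count0-flat m≤n λ z m<z z≤n → gap z m<z (m≤n⇒m≤1+n z≤n))

  count0-unbounded : IsRightFountain T → ∀ n → ∃ λ z → n < count0 T z
  count0-unbounded rf zero with IsRightFountain.fountain rf 1
  ... | w , 1≤w , w∈ = w , count0-< w∈ 1≤w
  count0-unbounded rf (suc n) with count0-unbounded rf n
  ... | z , n<cz with IsRightFountain.fountain rf (suc z)
  ...   | w , z<w , w∈ = w , ≤-<-trans n<cz (count0-< w∈ z<w)

  Y⇒< : Y T n a → n < a
  Y⇒< {a = a} (_ , _ , ca) = subst (_≤ a) ca count0-≤

  Y-< : Y T n a → Y T (suc n) b → a < b
  Y-< (_ , _ , ca) (_ , _ , cb) = ≰⇒> λ b≤a → 1+n≰n (subst₂ _≤_ cb ca (count0-mono-≤ b≤a))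

  Y-gap : Y T n a → Y T (suc n) b → a < m → m < b → ¬ (0 , m) ∈A T
  Y-gap (_ , _ , ca) (_ , b∈ , cb) a<m m<b m∈ = n≮n _
    (≤-<-trans (subst (_< _) ca (count0-< m∈ a<m)) (subst (_ <_) cb (count0-< b∈ m<b)))

  Y-of-∈ : (0 , suc z) ∈A T → Y T (count0 T z) (suc z)
  Y-of-∈ z∈ = s≤s z≤n , z∈ , count0-suc-∈ z∈

  Y-next : Y T n a → a < b → (0 , b) ∈A T → (∀ m → a < m → m < b → ¬ (0 , m) ∈A T) →
           Y T (suc n) b
  Y-next {b = suc b} (_ , _ , ca) (s≤s a≤b) b∈ gap =
    s≤s z≤n , b∈ , trans (count0-suc-∈ b∈) (cong suc (trans (count0-flat a≤b gap′) ca))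
    where gap′ = λ m a<m m≤b → gap m a<m (s≤s m≤b)

  Y-exists-below : ∀ z → n < count0 T z → ∃ (Y T n)
  Y-exists-below zero ()
  Y-exists-below {n} (suc z) n<c with n <? count0 T z | (0 , suc z) ∈A? T
  ... | yes n<c′ | _      = Y-exists-below z n<c′
  ... | no n≮c′  | no z∉  = contradiction (subst (n <_) (count0-suc-∉ z∉) n<c) n≮c′
  ... | no n≮c′  | yes z∈ = suc z , s≤s z≤n , z∈ , trans (count0-suc-∈ z∈) (cong suc c′≡n)
    where
    c′≡n : count0 T z ≡ n
    c′≡n = ≤-antisym (≮⇒≥ n≮c′) (≤-pred (subst (n <_) (count0-suc-∈ z∈) n<c))

  Y-exists : IsRightFountain T → ∀ n → ∃ (Y T n)
  Y-exists rf n = let z , n<cz = count0-unbounded rf n in Y-exists-below z n<cz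

  Y-arc : IsTriangulation T → Y T n a → Y T (suc n) b → (a , b) ∈A T
  Y-arc {a = a} {b} tri ya@(_ , a∈ , _) yb@(_ , b∈ , _) = maximal a b (Y-< ya yb) compat
    where
    open IsTriangulation tri
    compat : Compatible T a b
    compat c d cd∈ (inj₁ (a<c , c<b , b<d)) =
      noncrossing 0 b c d b∈ cd∈ (inj₁ (≤-<-trans z≤n a<c , c<b , b<d))
    compat zero d d∈ (inj₂ (_ , a<d , d<b)) = Y-gap ya yb a<d d<b d∈
    compat (suc c) d cd∈ (inj₂ (c<a , a<d , d<b)) =
      noncrossing 0 a (suc c) d a∈ cd∈ (inj₁ (s≤s z≤n , c<a , a<d))

  fountainArc-0 : 0 < b → (0 , b) ∈A T → FountainArc T 0 b
  fountainArc-0 {suc b} _ b∈ = inj₁ (refl , _ , Y-of-∈ b∈)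

  fountainArc-between : IsTriangulation T → 0 < a → (0 , a) ∈A T → (0 , b) ∈A T →
                        (a , b) ∈A T → FountainArc T a b
  fountainArc-between {suc a} {b} tri _ a∈ b∈ ab∈ =
    inj₂ (_ , Y-of-∈ a∈ , Y-next (Y-of-∈ a∈) (arcs _ _ ab∈) b∈ gap)
    where
    open IsTriangulation tri
    gap : ∀ m → suc a < m → m < b → ¬ (0 , m) ∈A T
    gap m a<m m<b m∈ = noncrossing (suc a) b 0 m ab∈ m∈ (inj₂ (s≤s z≤n , a<m , m<b))

-- Mutation sequences

ordinaryStep-preserves-fountain : IsTriangulation T → OrdinaryStep T T′ →
                                  ∀ x → T′ 0 x ≡ T 0 x
ordinaryStep-preserves-fountain tri (inj₁ T′≗T) x = T′≗T 0 x
ordinaryStep-preserves-fountain {T} tri (inj₂ (_ , _ , ¬fountain , m)) x with mutationView m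
... | flip-pr {p} {q} {r} {s} Q pr∈ T′≗ =
  trans (T′≗ 0 x) (replace-elsewhere T p r q s 0x≢pr (≢-by-fst (<⇒≢ 0<q)))
  where
  open Quadrilateral Q
  0<q = ≤-<-trans z≤n p<q
  0x≢pr : (0 , x) ≢ (p , r)
  0x≢pr refl = ¬fountain (fountainArc-0 T (<-trans 0<q q<r) pr∈)
... | flip-qs {p} {q} {r} {s} Q qs∈ T′≗ =
  trans (T′≗ 0 x) (replace-elsewhere T q s p r (≢-by-fst (<⇒≢ 0<q)) 0x≢pr)
  where
  open Quadrilateral Q
  0<q = ≤-<-trans z≤n p<q
  0x≢pr : (0 , x) ≢ (p , r)
  0x≢pr refl = ¬fountain (fountainArc-between T tri 0<q pq∈ ps∈ qs∈)

step-preserves-triangulation : IsTriangulation T → Step T T′ → IsTriangulation T′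
step-preserves-triangulation tri (inj₁ T′≗T)        = IsTriangulation-resp-≗₂ T′≗T tri
step-preserves-triangulation tri (inj₂ (_ , _ , m)) = mutation-preserves-triangulation tri m

step-local : Step T T′ → Σ ℕ λ B → ∀ x y → B < y → T′ x y ≡ T x y
step-local (inj₁ T′≗T)        = 0 , λ x y _ → T′≗T x y
step-local (inj₂ (_ , _ , m)) = mutation-local m

module _ (T : ℕ → ArcSet) (steps : ∀ k → Step (T k) (T (suc k))) where

  steps-preserve-triangulation : IsTriangulation (T 0) → ∀ k → IsTriangulation (T k)
  steps-preserve-triangulation tri zero    = tri
  steps-preserve-triangulation tri (suc k) =
    step-preserves-triangulation (steps-preserve-triangulation tri k) (steps k)

  steps-local : ∀ k → Σ ℕ λ B → ∀ x y → B < y → T k x y ≡ T 0 x y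
  steps-local zero    = 0 , λ _ _ _ → refl
  steps-local (suc k) with steps-local k | step-local (steps k)
  ... | B , Tₖ≈T₀ | B′ , Tₖ₊₁≈Tₖ = B ⊔ B′ , λ x y B⊔B′<y →
    trans (Tₖ₊₁≈Tₖ x y (m⊔n<o⇒n<o B B′ B⊔B′<y)) (Tₖ≈T₀ x y (m⊔n<o⇒m<o B B′ B⊔B′<y))

ordinarySteps-preserve-fountain : (T : ℕ → ArcSet) {K : ℕ} → (∀ k → IsTriangulation (T k)) →
  (∀ k → K ≤ k → OrdinaryStep (T k) (T (suc k))) → ∀ j x → T (j + K) 0 x ≡ T K 0 x
ordinarySteps-preserve-fountain T tris ordinary zero    x = refl
ordinarySteps-preserve-fountain T {K} tris ordinary (suc j) x =
  trans (ordinaryStep-preserves-fountain (tris (j + K)) (ordinary (j + K) (m≤n+m K j)) x)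
        (ordinarySteps-preserve-fountain T tris ordinary j x)

∼⇒fountain-eventually-equal : IsTriangulation T → T ∼ T′ →
                              Σ ℕ λ B → ∀ x → B < x → T′ 0 x ≡ T 0 x
∼⇒fountain-eventually-equal {T} {T′} tri (Tₖ , T₀≗T , steps , (K , ordinary) , converges) =
  B , agree
  where
  open ≡-Reasoning
  tris = steps-preserve-triangulation Tₖ steps (IsTriangulation-resp-≗₂ T₀≗T tri)
  B = proj₁ (steps-local Tₖ steps K)
  agree : ∀ x → B < x → T′ 0 x ≡ T 0 x
  agree x B<x = let L , Tₖ→T′ = converges 0 x in begin
    T′ 0 x         ≡⟨ sym (Tₖ→T′ (L + K) (m≤m+n L K)) ⟩
    Tₖ (L + K) 0 x ≡⟨ ordinarySteps-preserve-fountain Tₖ tris ordinary L x ⟩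
    Tₖ K 0 x       ≡⟨ proj₂ (steps-local Tₖ steps K) 0 x B<x ⟩
    Tₖ 0 0 x       ≡⟨ T₀≗T 0 x ⟩
    T 0 x          ∎

∼-refl : T ∼ T
∼-refl = (λ _ → _) , (λ _ _ → refl) , (λ _ → inj₁ λ _ _ → refl) ,
         (0 , λ _ _ → inj₁ λ _ _ → refl) , λ _ _ → 0 , λ _ _ → refl

Mutation : ArcSet → ArcSet → Set
Mutation T T′ = ∃₂ λ a b → MutAt T a b T′

mutation-∼ : Mutation T T′ → T′ ∼ R → T ∼ R
mutation-∼ {T} {R = R} (a , b , m) (Tₖ , T₀≗T′ , steps , (K , ordinary) , converges) =
  T⁺ , (λ _ _ → refl) , steps⁺ , (suc K , ordinary⁺) , converges⁺
  where
  T⁺ : ℕ → ArcSet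
  T⁺ zero    = T
  T⁺ (suc k) = Tₖ k
  steps⁺ : ∀ k → Step (T⁺ k) (T⁺ (suc k))
  steps⁺ zero    = inj₂ (a , b , MutAt-resp-≗₂ T₀≗T′ m)
  steps⁺ (suc k) = steps k
  ordinary⁺ : ∀ k → suc K ≤ k → OrdinaryStep (T⁺ k) (T⁺ (suc k))
  ordinary⁺ (suc k) (s≤s K≤k) = ordinary k K≤k
  converges⁺ : ∀ x y → Σ ℕ λ L → ∀ k → L ≤ k → T⁺ k x y ≡ R x y
  converges⁺ x y with converges x y
  ... | L , conv = suc L , λ { (suc k) (s≤s L≤k) → conv k L≤k }

Star⇒∼ : Star Mutation T T′ → T ∼ T′
Star⇒∼ = fold _∼_ mutation-∼ ∼-refl

-- Sparse fountains

SparseFrom : ArcSet → ℕ → Set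
SparseFrom T M = ∀ n → M ≤ n → ∀ a b → Y T n a → Y T (suc n) b → 2 + a ≤ b

sparse⇒no-adjacent-fountain-points : IsTriangulation T → SparseFrom T 1 →
                                     2 ≤ a → (0 , a) ∈A T → ¬ (0 , suc a) ∈A T
sparse⇒no-adjacent-fountain-points {T} {suc a} tri sparse (s≤s 1≤a) a∈ a+1∈ =
  1+n≰n (sparse (count0 T a) 1≤n (suc a) (suc (suc a)) ya yb)
  where
  ya = Y-of-∈ T a∈
  yb = Y-next T ya ≤-refl a+1∈ λ m a<m m<a+2 _ → <⇒≱ a<m (≤-pred m<a+2)
  1≤n : 1 ≤ count0 T a
  1≤n = subst (_≤ count0 T a) (count0-suc-∈ T (boundaryArc-∈ tri)) (count0-mono-≤ T 1≤a)

Special⇒FinitelyManyBoundaryY : Special R → FinitelyManyBoundaryY R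
Special⇒FinitelyManyBoundaryY {R} (R′ , rf′ , R′∼R , sparse′) = suc B , no-boundary
  where
  tri′  = IsRightFountain.triangulation rf′
  B     = proj₁ (∼⇒fountain-eventually-equal tri′ R′∼R)
  agree = proj₂ (∼⇒fountain-eventually-equal tri′ R′∼R)
  ∈R′ : (0 , x) ∈A R → B < x → (0 , x) ∈A R′
  ∈R′ {x} x∈ B<x = trans (sym (agree x B<x)) x∈
  no-boundary : ∀ n → suc B ≤ n → ∀ a b → Y R n a → Y R (suc n) b → b ≢ suc a
  no-boundary n B<n a _ ya@(_ , a∈ , _) (_ , a+1∈ , _) refl =
    sparse⇒no-adjacent-fountain-points tri′ sparse′ 2≤a (∈R′ a∈ B<a) (∈R′ a+1∈ (m<n⇒m<1+n B<a))
    where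
    B<a : B < a
    B<a = <-trans B<n (Y⇒< R ya)
    2≤a : 2 ≤ a
    2≤a = ≤-trans (s≤s (≤-trans (s≤s z≤n) B<n)) (Y⇒< R ya)

fountain-quadrilateral : IsTriangulation T → Y T n q → Y T (suc n) r → Y T (suc (suc n)) s →
                         Quadrilateral T 0 q r s
fountain-quadrilateral {T} tri yq@(1≤q , q∈ , _) yr ys@(_ , s∈ , _) =
  quadrilateral 1≤q (Y-< T yq yr) (Y-< T yr ys) q∈ (Y-arc T tri yq yr) (Y-arc T tri yr ys) s∈

count0-remove-below : ∀ T T′ → (∀ z → z ≢ r → T′ 0 z ≡ T 0 z) → z < r →
                      count0 T′ z ≡ count0 T z
count0-remove-below T T′ agree z<r =
  count0-cong T′ T λ w w≤z → agree w (<⇒≢ (≤-<-trans w≤z z<r))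

count0-remove-above : ∀ T T′ → (∀ z → z ≢ r → T′ 0 z ≡ T 0 z) →
                      1 ≤ r → (0 , r) ∈A T → ¬ (0 , r) ∈A T′ →
                      r ≤ z → suc (count0 T′ z) ≡ count0 T z
count0-remove-above {z = zero} T T′ agree 1≤r r∈ r∉′ r≤0 = contradiction r≤0 (<⇒≱ 1≤r)
count0-remove-above {z = suc z} T T′ agree 1≤r r∈ r∉′ r≤1+z with m≤n⇒m<n∨m≡n r≤1+z
... | inj₂ refl = begin
  suc (count0 T′ (suc z)) ≡⟨ cong suc (count0-suc-∉ T′ r∉′) ⟩
  suc (count0 T′ z)       ≡⟨ cong suc (count0-remove-below T T′ agree ≤-refl) ⟩
  suc (count0 T z)        ≡⟨ sym (count0-suc-∈ T r∈) ⟩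
  count0 T (suc z)        ∎
  where open ≡-Reasoning
... | inj₁ (s≤s r≤z) = count0-suc-cong T′ T (agree (suc z) (>⇒≢ (s≤s r≤z)))
  (count0-remove-above T T′ agree 1≤r r∈ r∉′ r≤z)

Y-remove : ∀ T T′ → (∀ z → z ≢ r → T′ 0 z ≡ T 0 z) → ¬ (0 , r) ∈A T′ →
           Y T m r → m ≤ n → Y T′ n a → Y T (suc n) a
Y-remove {r} {m} {n} {a} T T′ agree r∉′ (1≤r , r∈ , cr) m≤n (1≤a , a∈′ , ca)
  with <-cmp a r
... | tri≈ _ refl _ = contradiction a∈′ r∉′
... | tri< a<r _ _  = contradiction m≤n (<⇒≱ n<m)
  where
  ca′ = trans (sym (count0-remove-below T T′ agree a<r)) ca
  n<m : n < m
  n<m = ≤-pred (subst₂ _<_ ca′ cr (count0-< T r∈ a<r))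
... | tri> _ a≢r r<a = 1≤a , trans (sym (agree a a≢r)) a∈′ ,
  trans (sym (count0-remove-above T T′ agree 1≤r r∈ r∉′ (<⇒≤ r<a))) (cong suc ca)

sparsify-step : IsRightFountain R → SparseFrom R (2 + M) →
                Σ ArcSet λ R₁ → IsRightFountain R₁ × SparseFrom R₁ (1 + M) × Mutation R₁ R
sparsify-step {R} {M} rf sparse
  with Y-exists R rf M | Y-exists R rf (1 + M) | Y-exists R rf (2 + M)
... | q , yq | r , yr@(_ , r∈ , _) | s , ys =
  R₁ , mutation-preserves-rightFountain rf (mutAt-pr Q r∈ λ _ _ → refl) , sparse₁ ,
  q , s , flip-pr-reversible triangulation Q r∈
  where
  open IsRightFountain rf
  Q  = fountain-quadrilateral triangulation yq yr ys
  R₁ = replace R 0 r q s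
  agree : ∀ z → z ≢ r → R₁ 0 z ≡ R 0 z
  agree z z≢r =
    replace-elsewhere R 0 r q s (≢-by-snd z≢r) (≢-by-fst (<⇒≢ (Quadrilateral.p<q Q)))
  lift : 1 + M ≤ n → Y R₁ n a → Y R (suc n) a
  lift = Y-remove R R₁ agree (replace-removes R 0 r q s) yr
  sparse₁ : SparseFrom R₁ (1 + M)
  sparse₁ n M<n a b ya yb =
    sparse (suc n) (s≤s M<n) a b (lift M<n ya) (lift (m≤n⇒m≤1+n M<n) yb)

sparsify : ∀ M → IsRightFountain R → SparseFrom R (suc M) →
           Σ ArcSet λ R′ → IsRightFountain R′ × Star Mutation R′ R × SparseFrom R′ 1
sparsify zero    rf sparse = _ , rf , ε , sparse
sparsify (suc M) rf sparse with sparsify-step rf sparse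
... | R₁ , rf₁ , sparse₁ , R₁→R with sparsify M rf₁ sparse₁
...   | R′ , rf′ , R′→R₁ , sparse′ = R′ , rf′ , R′→R₁ ◅◅ (R₁→R ◅ ε) , sparse′

FinitelyManyBoundaryY⇒Special : IsRightFountain R → FinitelyManyBoundaryY R → Special R
FinitelyManyBoundaryY⇒Special {R} rf (N , no-boundary) =
  let R′ , rf′ , R′→R , sparse′ = sparsify N rf sparse in R′ , rf′ , Star⇒∼ R′→R , sparse′
  where
  sparse : SparseFrom R (suc N)
  sparse n N<n a b ya yb =
    ≤∧≢⇒< (Y-< R ya yb) λ 1+a≡b → no-boundary n (<⇒≤ N<n) a b ya yb (sym 1+a≡b)

proposition3p18 : (R : ArcSet) → IsRightFountain R →
    Special R ⇔ FinitelyManyBoundaryY R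
proposition3p18 R rf = mk⇔ Special⇒FinitelyManyBoundaryY (FinitelyManyBoundaryY⇒Special rf)
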